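{- Let $G$ be a strong simple game with $n$ players. If $G$ has a losing coalition of cardinality $n-2$, then $G$ is roughly weighted.
   Context: A simple game is $(P,W)$ with $P=[n]$, $W\subseteq 2^P$ (winning coalitions) closed under supersets within $P$, $W\ne\emptyset$, $W\ne 2^P$; other coalitions are losing. It is strong if $X$ losing implies $P\setminus X$ winning. It is roughly weighted if there exist non-negative reals $w_1,\dots,w_n$ and a real $q$, not all zero, such that $\sum_{i\in X}w_i<q$ implies $X$ losing and $\sum_{i\in X}w_i>q$ implies $X$ winning. -}

module Defs where

open import Data.Nat using (ℕ; zero; suc)
open import Data.Fin using (Fin; zero; suc)
open import Data.Bool using (Bool; true; false)
open import Data.Vec using ([]; _∷_)
open import Data.Fin.Subset using (Subset; inside; outside; _⊆_; ∁; ∣_∣)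
open import Data.Rational using (ℚ; 0ℚ; _+_; _<_; _≤_)
open import Data.Product using (Σ; ∃; _×_)
open import Relation.Binary.PropositionalEquality using (_≡_)
open import Relation.Nullary using (¬_)

record SimpleGame (n : ℕ) : Set where
  field
    win : Subset n → Bool

  Winning : Subset n → Set
  Winning X = win X ≡ true

  Losing : Subset n → Set
  Losing X = ¬ Winning X

  field
    monotone  : ∀ {X Y} → X ⊆ Y → Winning X → Winning Y
    nonempty  : ∃ λ X → Winning X
    notAll    : ∃ λ X → Losing X

open SimpleGame public

IsStrong : ∀ {n} → SimpleGame n → Set
IsStrong G = ∀ X → Losing G X → Winning G (∁ X)

weight : ∀ {n} → (Fin n → ℚ) → Subset n → ℚ
weight {zero}  w []            = 0ℚ
weight {suc n} w (inside  ∷ X) = w zero + weight (λ i → w (suc i)) X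
weight {suc n} w (outside ∷ X) = weight (λ i → w (suc i)) X

IsRoughlyWeighted : ∀ {n} → SimpleGame n → Set
IsRoughlyWeighted {n} G =
  Σ (Fin n → ℚ) λ w → Σ ℚ λ q →
    (∀ i → 0ℚ ≤ w i) ×
    ¬ ((∀ i → w i ≡ 0ℚ) × q ≡ 0ℚ) ×
    (∀ X → weight w X < q → Losing G X) ×
    (∀ X → q < weight w X → Winning G X)

-- Let X be a losing coalition whose complement {a, b} has two players; by
-- strength {a, b} is winning.  Give a and b weight 1, everybody else weight 0,
-- and take quota 1.  A coalition of weight below 1 contains neither a nor b,
-- so it lies inside X and loses; one of weight above 1 contains both, so it
-- contains the winning coalition {a, b} and wins.
module Submission where

open import Defs
open import Data.Nat using (ℕ; zero; suc; _+_; _∸_; _≤_; _<_; z≤n; s≤s)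
open import Data.Nat.Properties using (m+n∸m≡n; ≤-<-trans; <-irrefl)
open import Data.Bool using (if_then_else_)
open import Data.Vec using ([]; _∷_; lookup)
open import Data.Fin using (Fin)
open import Data.Fin.Subset using (Subset; inside; outside; _∈_; _⊆_; ∁; _∩_; ∣_∣)
open import Data.Fin.Subset.Properties
  using (_∈?_; x∈p⇒∣p-x∣<∣p∣; x∉p⇒x∈∁p; x∈p∩q⁺; p∩q⊆p; p∩q⊆q; p⊂q⇒∣p∣<∣q∣; ∣∁p∣≡n∸∣p∣)
open import Data.Rational using (ℚ; 0ℚ; 1ℚ)
  renaming (_≤_ to _≤ℚ_; _<_ to _<ℚ_; _+_ to _+ℚ_)
import Data.Rational.Properties as ℚ
open import Data.Product using (∃; _×_; _,_; proj₂)
open import Function using (_∘_)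
open import Relation.Nullary using (yes; no; contradiction)
open import Relation.Binary.PropositionalEquality using (_≡_; refl; sym; trans; cong; subst)

x∈p⇒0<∣p∣ : ∀ {n} {x : Fin n} {p : Subset n} → x ∈ p → 0 < ∣ p ∣
x∈p⇒0<∣p∣ x∈p = ≤-<-trans z≤n (x∈p⇒∣p-x∣<∣p∣ x∈p)

∣p∩∁q∣≡0⇒p⊆q : ∀ {n} {p q : Subset n} → ∣ p ∩ ∁ q ∣ ≡ 0 → p ⊆ q
∣p∩∁q∣≡0⇒p⊆q {p = p} {q} ∣p∩∁q∣≡0 {x} x∈p with x ∈? q
... | yes x∈q = x∈q
... | no  x∉q = contradiction (subst (0 <_) ∣p∩∁q∣≡0 (x∈p⇒0<∣p∣ x∈p∩∁q)) (<-irrefl refl)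
  where
  x∈p∩∁q : x ∈ p ∩ ∁ q
  x∈p∩∁q = x∈p∩q⁺ (x∈p , x∉p⇒x∈∁p x∉q)

p⊆q∧∣q∣≤∣p∣⇒q⊆p : ∀ {n} {p q : Subset n} → p ⊆ q → ∣ q ∣ ≤ ∣ p ∣ → q ⊆ p
p⊆q∧∣q∣≤∣p∣⇒q⊆p {p = p} p⊆q ∣q∣≤∣p∣ {x} x∈q with x ∈? p
... | yes x∈p = x∈p
... | no  x∉p =
  contradiction (≤-<-trans ∣q∣≤∣p∣ (p⊂q⇒∣p∣<∣q∣ (p⊆q , x , x∈q , x∉p))) (<-irrefl refl)

-- The unary embedding, rather than a normalising division, makes
-- fromℕ (suc k) ≡ 1ℚ + fromℕ k hold by definition.
fromℕ : ℕ → ℚ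
fromℕ zero    = 0ℚ
fromℕ (suc k) = 1ℚ +ℚ fromℕ k

0≤1ℚ : 0ℚ ≤ℚ 1ℚ
0≤1ℚ = ℚ.<⇒≤ (ℚ.positive⁻¹ 1ℚ)

fromℕ-nonneg : ∀ k → 0ℚ ≤ℚ fromℕ k
fromℕ-nonneg zero    = ℚ.≤-refl
fromℕ-nonneg (suc k) = ℚ.+-mono-≤ 0≤1ℚ (fromℕ-nonneg k)

1≤fromℕ-suc : ∀ k → 1ℚ ≤ℚ fromℕ (suc k)
1≤fromℕ-suc k =
  subst (_≤ℚ fromℕ (suc k)) (ℚ.+-identityʳ 1ℚ) (ℚ.+-monoʳ-≤ 1ℚ (fromℕ-nonneg k))

fromℕ<1⇒≡0 : ∀ {k} → fromℕ k <ℚ 1ℚ → k ≡ 0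
fromℕ<1⇒≡0 {zero}  _    = refl
fromℕ<1⇒≡0 {suc k} k<1 = contradiction (ℚ.<-≤-trans k<1 (1≤fromℕ-suc k)) (ℚ.<-irrefl refl)

1<fromℕ⇒2≤ : ∀ {k} → 1ℚ <ℚ fromℕ k → 2 ≤ k
1<fromℕ⇒2≤ {zero}        1<0 = contradiction (ℚ.<-≤-trans 1<0 0≤1ℚ) (ℚ.<-irrefl refl)
1<fromℕ⇒2≤ {suc zero}    1<1 = contradiction 1<1 (ℚ.<-irrefl (sym (ℚ.+-identityʳ 1ℚ)))
1<fromℕ⇒2≤ {suc (suc k)} _   = s≤s (s≤s z≤n)

indicator : ∀ {n} → Subset n → Fin n → ℚ
indicator Z i = if lookup Z i then 1ℚ else 0ℚ

indicator-nonneg : ∀ {n} (Z : Subset n) i → 0ℚ ≤ℚ indicator Z i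
indicator-nonneg Z i with lookup Z i
... | inside  = 0≤1ℚ
... | outside = ℚ.≤-refl

weight-indicator : ∀ {n} (Z Y : Subset n) → weight (indicator Z) Y ≡ fromℕ ∣ Y ∩ Z ∣
weight-indicator []            []            = refl
weight-indicator (inside  ∷ Z) (inside  ∷ Y) = cong (1ℚ +ℚ_) (weight-indicator Z Y)
weight-indicator (outside ∷ Z) (inside  ∷ Y) = trans (ℚ.+-identityˡ _) (weight-indicator Z Y)
weight-indicator (_       ∷ Z) (outside ∷ Y) = weight-indicator Z Y

losing∧∁winning∧∣∁∣≡2⇒roughlyWeighted :
  ∀ {n} (G : SimpleGame n) (X : Subset n) →
  Losing G X → Winning G (∁ X) → ∣ ∁ X ∣ ≡ 2 → IsRoughlyWeighted G
losing∧∁winning∧∣∁∣≡2⇒roughlyWeighted G X X-losing ∁X-winning ∣∁X∣≡2 =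
  indicator (∁ X) , 1ℚ , indicator-nonneg (∁ X) , ℚ.1≢0 ∘ proj₂ , light-loses , heavy-wins
  where
  light-loses : ∀ Y → weight (indicator (∁ X)) Y <ℚ 1ℚ → Losing G Y
  light-loses Y w<1 = X-losing ∘ monotone G Y⊆X
    where
    Y⊆X : Y ⊆ X
    Y⊆X = ∣p∩∁q∣≡0⇒p⊆q (fromℕ<1⇒≡0 (subst (_<ℚ 1ℚ) (weight-indicator (∁ X) Y) w<1))

  heavy-wins : ∀ Y → 1ℚ <ℚ weight (indicator (∁ X)) Y → Winning G Y
  heavy-wins Y 1<w = monotone G (p∩q⊆p Y (∁ X) ∘ ∁X⊆Y∩∁X) ∁X-winning
    where
    2≤∣Y∩∁X∣ : 2 ≤ ∣ Y ∩ ∁ X ∣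
    2≤∣Y∩∁X∣ = 1<fromℕ⇒2≤ (subst (1ℚ <ℚ_) (weight-indicator (∁ X) Y) 1<w)

    ∁X⊆Y∩∁X : ∁ X ⊆ Y ∩ ∁ X
    ∁X⊆Y∩∁X = p⊆q∧∣q∣≤∣p∣⇒q⊆p (p∩q⊆q Y (∁ X))
                (subst (_≤ ∣ Y ∩ ∁ X ∣) (sym ∣∁X∣≡2) 2≤∣Y∩∁X∣)

corollary6 : (n : ℕ) (G : SimpleGame n) → IsStrong G →
    (∃ λ (X : Subset n) → Losing G X × ∣ X ∣ + 2 ≡ n) →
    IsRoughlyWeighted G
corollary6 n G strong (X , X-losing , ∣X∣+2≡n) =
  losing∧∁winning∧∣∁∣≡2⇒roughlyWeighted G X X-losing (strong X X-losing) ∣∁X∣≡2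
  where
  ∣∁X∣≡2 : ∣ ∁ X ∣ ≡ 2
  ∣∁X∣≡2 = trans (∣∁p∣≡n∸∣p∣ X) (subst (λ m → m ∸ ∣ X ∣ ≡ 2) ∣X∣+2≡n (m+n∸m≡n ∣ X ∣ 2))
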